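{- Let $p\in\mathbb{T}^{\mathcal{P}(n)}$ be a tropical Plücker vector and $L_p\subseteq\mathbb{T}^n$ its tropical linear space. Under the identification $\mathbb{T}^{\mathcal{J}}\cong\mathbb{T}^n\times\mathbb{T}^n$ (first factor the coordinates $1,\dots,n$, second the coordinates $1^*,\dots,n^*$), one has $\mathcal{C}(p)^\top=L_p\times L_{p^*}$.
   Context: $[n]=\{1,\dots,n\}$, $\mathcal{P}(n)$ its power set, $\mathbb{T}=\mathbb{R}\cup\{\infty\}$, $\mathrm{supp}(p)=\{S:p_S\ne\infty\}$. $p$ is a tropical Wick vector if for all $S,T\subseteq[n]$ the minimum $\min_{i\in S\Delta T}(p_{S\Delta\{i\}}+p_{T\Delta\{i\}})$ is attained at least twice or equals $\infty$; a tropical Plücker vector is a tropical Wick vector with nonempty support all of whose support sets have the same size $r_p$ (its rank). The dual is $p^*_S=p_{[n]\setminus S}$. Plücker circuits: for $T\subseteq[n]$ with $|T|=r_p+1$, $d_T\in\mathbb{T}^n$ has $(d_T)_i=p_{T\setminus\{i\}}$ if $i\in T$ and $\infty$ otherwise; the Plücker circuits of $p$ are the vectors $d_T+\lambda\mathbf{1}$, $\lambda\in\mathbb{R}$, with nonempty support, and $L_p$ is the set of vectors in $\mathbb{T}^n$ tropically orthogonal to all Plücker circuits of $p$. $\mathcal{J}=[n]\cup[n]^*$; for $S\subseteq[n]$, $\bar S=S\cup([n]\setminus S)^*$, $\bar p_{\bar S}=p_S$; for $T\subseteq[n]$, $(c_T)_i=\bar p_{\bar T\Delta\{i,i^*\}}$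 if $i\in\bar T$, else $\infty$. Circuits of $p$ are the vectors $c_T+\lambda\mathbf{1}$ with nonempty support; $\mathcal{C}(p)$ is their set. $x,y$ are tropically orthogonal if $\min_k(x_k+y_k)$ is attained at least twice or is $\infty$; $X^\top$ is the set of vectors tropically orthogonal to all elements of $X$. -}

module Defs where

open import Level using (0ℓ)
open import Data.Nat using (ℕ; suc)
open import Data.Fin using (Fin)
open import Data.Bool using (Bool; true; false; if_then_else_; _xor_)
open import Data.Maybe using (Maybe; just; nothing)
open import Data.Vec using (lookup; zipWith)
open import Data.Fin.Subset using (Subset; ⁅_⁆; ∁; ∣_∣)
open import Data.Sum using (_⊎_; inj₁; inj₂)
open import Data.Product using (Σ; ∃; _×_; _,_)
open import Data.Unit using (⊤)
open import Data.Empty using (⊥)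
open import Relation.Nullary using (¬_)
open import Relation.Binary.PropositionalEquality using (_≡_; _≢_)
open import Algebra.Structures using (IsAbelianGroup)
open import Relation.Binary.Structures using (IsTotalOrder)

-- An axiomatic model of the ordered additive group (ℝ, +, ≤):
-- a nontrivial, densely and totally ordered abelian group that is
-- Dedekind complete.  These axioms characterise (ℝ, +, ≤) up to
-- isomorphism; only + and ≤ on ℝ enter the statement.

record RealLine : Set₁ where
  infixl 6 _+_
  infix 4 _≤_ _<_
  field
    ℝ       : Set
    _+_     : ℝ → ℝ → ℝ
    0ℝ      : ℝ
    -_      : ℝ → ℝ
    _≤_     : ℝ → ℝ → Set
    isAbelianGroup : IsAbelianGroup _≡_ _+_ 0ℝ -_
    isTotalOrder   : IsTotalOrder _≡_ _≤_
    +-mono-≤       : ∀ {a b} c → a ≤ b → a + c ≤ b + c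
  _<_ : ℝ → ℝ → Set
  a < b = (a ≤ b) × (a ≢ b)
  field
    nontrivial : ∃ λ a → a ≢ 0ℝ
    dense      : ∀ {a b} → a < b → ∃ λ c → (a < c) × (c < b)
    complete   : (P : ℝ → Set) → (∃ λ x → P x) →
                 (∃ λ b → ∀ x → P x → x ≤ b) →
                 ∃ λ s → (∀ x → P x → x ≤ s) ×
                         (∀ b → (∀ x → P x → x ≤ b) → s ≤ b)

module Trop (R : RealLine) where
  open RealLine R

  𝕋 : Set
  𝕋 = Maybe ℝ

  ∞ : 𝕋
  ∞ = nothing

  _≤𝕋_ : 𝕋 → 𝕋 → Set
  just a  ≤𝕋 just b  = a ≤ b
  just a  ≤𝕋 nothing = ⊤
  nothing ≤𝕋 just b  = ⊥
  nothing ≤𝕋 nothing = ⊤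

  _⊗_ : 𝕋 → 𝕋 → 𝕋
  just a ⊗ just b = just (a + b)
  _      ⊗ _      = nothing

  MinTwiceOrInf : {I : Set} → (P : I → Set) → (f : I → 𝕋) → Set
  MinTwiceOrInf {I} P f =
    (∀ k → P k → f k ≡ ∞) ⊎
    (Σ I λ i → Σ I λ j → (i ≢ j) × P i × P j × (f i ≡ f j) ×
       (∀ k → P k → f i ≤𝕋 f k))

  Orth : {I : Set} → (I → 𝕋) → (I → 𝕋) → Set
  Orth x y = MinTwiceOrInf (λ _ → ⊤) (λ k → x k ⊗ y k)

  _+λ_ : {I : Set} → (I → 𝕋) → ℝ → (I → 𝕋)
  (x +λ l) k = x k ⊗ just l

  NonemptySupport : {I : Set} → (I → 𝕋) → Set
  NonemptySupport {I} x = Σ I λ k → x k ≢ ∞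

  _Δ_ : ∀ {n} → Subset n → Subset n → Subset n
  S Δ T = zipWith _xor_ S T

  InS : ∀ {n} → Fin n → Subset n → Set
  InS i S = lookup S i ≡ true

  Vec𝒫 : ℕ → Set
  Vec𝒫 n = Subset n → 𝕋

  IsWick : ∀ {n} → Vec𝒫 n → Set
  IsWick {n} p = ∀ (S T : Subset n) →
    MinTwiceOrInf (λ i → InS i (S Δ T))
                  (λ i → p (S Δ ⁅ i ⁆) ⊗ p (T Δ ⁅ i ⁆))

  IsPlücker : ∀ {n} → Vec𝒫 n → Set
  IsPlücker {n} p =
    IsWick p ×
    (∃ λ (S : Subset n) → p S ≢ ∞) ×
    (∀ (S S′ : Subset n) → p S ≢ ∞ → p S′ ≢ ∞ → ∣ S ∣ ≡ ∣ S′ ∣)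

  dual : ∀ {n} → Vec𝒫 n → Vec𝒫 n
  dual p S = p (∁ S)

  -- |T| = r_p + 1, where r_p is the common size of the support sets of p
  HasRankPlusOne : ∀ {n} → Vec𝒫 n → Subset n → Set
  HasRankPlusOne {n} p T = ∃ λ (S : Subset n) → (p S ≢ ∞) × (∣ T ∣ ≡ suc ∣ S ∣)

  dVec : ∀ {n} → Vec𝒫 n → Subset n → Fin n → 𝕋
  dVec p T i = if lookup T i then p (T Δ ⁅ i ⁆) else ∞

  L : ∀ {n} → Vec𝒫 n → (Fin n → 𝕋) → Set
  L {n} p x = ∀ (T : Subset n) → HasRankPlusOne p T → ∀ (l : ℝ) →
    NonemptySupport (dVec p T +λ l) → Orth x (dVec p T +λ l)

  -- 𝒥 = [n] ∪ [n]*: inj₁ i is i, inj₂ i is i*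
  𝒥 : ℕ → Set
  𝒥 n = Fin n ⊎ Fin n

  -- membership in S̄ = S ∪ ([n] ∖ S)*
  inBar : ∀ {n} → Subset n → 𝒥 n → Bool
  inBar S (inj₁ i) = lookup S i
  inBar S (inj₂ i) = lookup (∁ S) i

  base : ∀ {n} → 𝒥 n → Fin n
  base (inj₁ i) = i
  base (inj₂ i) = i

  -- c_T: (c_T)_j = p̄_{T̄ Δ {i,i*}} for j ∈ T̄ (i = base j), else ∞.
  -- Since T̄ Δ {i,i*} = \overline{T Δ {i}}, p̄_{T̄ Δ {i,i*}} = p_{T Δ {i}}.
  cVec : ∀ {n} → Vec𝒫 n → Subset n → 𝒥 n → 𝕋
  cVec p T j = if inBar T j then p (T Δ ⁅ base j ⁆) else ∞

  InCircuitsPerp : ∀ {n} → Vec𝒫 n → (𝒥 n → 𝕋) → Set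
  InCircuitsPerp {n} p x = ∀ (T : Subset n) (l : ℝ) →
    NonemptySupport (cVec p T +λ l) → Orth x (cVec p T +λ l)

-- Only the homogeneity of p matters.  If the support
-- sets of p all have size r, an entry c_T(i) ≠ ∞ with i ∈ T forces |T| = r + 1, while an
-- entry c_T(i*) ≠ ∞ with i ∉ T forces |T| = r − 1; so every circuit lives on one of the
-- two blocks of 𝒥.  On the first block c_T is the Plücker circuit d_T of p, on the second
-- it is the Plücker circuit d_{[n]∖T} of p*, and orthogonality to a vector supported on
-- one block only involves that block.
module Submission where

open import Defs
open import Data.Nat using (ℕ; suc)
open import Data.Nat.Properties using (m≢1+n+m)
open import Data.Fin using (zero; suc)
open import Data.Fin.Subset using (Subset; ⁅_⁆; ∁; ∣_∣; ⊥)
open import Data.Bool using (true; false; not; if_then_else_)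
open import Data.Bool.Properties using (xor-identityʳ; not-distribˡ-xor; not-involutive)
open import Data.Maybe using (just; nothing)
open import Data.Vec using ([]; _∷_; lookup)
open import Data.Vec.Properties using (lookup-map; map-∘; map-cong; map-id)
open import Data.Sum using (_⊎_; inj₁; inj₂)
open import Data.Sum.Properties using (inj₁-injective; inj₂-injective)
open import Data.Product using (∃; _×_; _,_)
open import Data.Unit using (⊤; tt)
open import Data.Empty using (⊥-elim)
open import Function using (_∘_)
open import Function.Bundles using (_⇔_; mk⇔; Equivalence)
open import Function.Construct.Composition using (_⇔-∘_)
open import Relation.Nullary using (¬_)
open import Relation.Binary.PropositionalEquality
open ≡-Reasoning

module CircuitSpace (R : RealLine) where
  open Trop R

  Δ-identityʳ : ∀ {n} (S : Subset n) → S Δ ⊥ ≡ S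
  Δ-identityʳ []      = refl
  Δ-identityʳ (a ∷ S) = cong₂ _∷_ (xor-identityʳ a) (Δ-identityʳ S)

  ∁-distribˡ-Δ : ∀ {n} (S U : Subset n) → ∁ (S Δ U) ≡ ∁ S Δ U
  ∁-distribˡ-Δ []      []      = refl
  ∁-distribˡ-Δ (a ∷ S) (b ∷ U) = cong₂ _∷_ (not-distribˡ-xor a b) (∁-distribˡ-Δ S U)

  ∁-involutive : ∀ {n} (S : Subset n) → ∁ (∁ S) ≡ S
  ∁-involutive S = trans (sym (map-∘ not not S)) (trans (map-cong not-involutive S) (map-id S))

  ∣S∣≡1+∣SΔ⁅i⁆∣ : ∀ {n} (S : Subset n) i → InS i S → ∣ S ∣ ≡ suc ∣ S Δ ⁅ i ⁆ ∣
  ∣S∣≡1+∣SΔ⁅i⁆∣ (true  ∷ S) zero    _   = cong (suc ∘ ∣_∣) (sym (Δ-identityʳ S))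
  ∣S∣≡1+∣SΔ⁅i⁆∣ (true  ∷ S) (suc i) i∈S = cong suc (∣S∣≡1+∣SΔ⁅i⁆∣ S i i∈S)
  ∣S∣≡1+∣SΔ⁅i⁆∣ (false ∷ S) (suc i) i∈S = ∣S∣≡1+∣SΔ⁅i⁆∣ S i i∈S

  ∣SΔ⁅i⁆∣≡1+∣S∣ : ∀ {n} (S : Subset n) i → lookup S i ≡ false → ∣ S Δ ⁅ i ⁆ ∣ ≡ suc ∣ S ∣
  ∣SΔ⁅i⁆∣≡1+∣S∣ (false ∷ S) zero    _   = cong (suc ∘ ∣_∣) (Δ-identityʳ S)
  ∣SΔ⁅i⁆∣≡1+∣S∣ (true  ∷ S) (suc i) i∉S = cong suc (∣SΔ⁅i⁆∣≡1+∣S∣ S i i∉S)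
  ∣SΔ⁅i⁆∣≡1+∣S∣ (false ∷ S) (suc i) i∉S = ∣SΔ⁅i⁆∣≡1+∣S∣ S i i∉S

  a⊗∞≡∞ : ∀ (a : 𝕋) → a ⊗ ∞ ≡ ∞
  a⊗∞≡∞ (just _) = refl
  a⊗∞≡∞ nothing  = refl

  a≤𝕋∞ : ∀ (a : 𝕋) → a ≤𝕋 ∞
  a≤𝕋∞ (just _) = tt
  a≤𝕋∞ nothing  = tt

  ∞≤𝕋a⇒a≡∞ : ∀ {a : 𝕋} → ∞ ≤𝕋 a → a ≡ ∞
  ∞≤𝕋a⇒a≡∞ {nothing} _ = refl

  ¬≢∞⇒≡∞ : ∀ {a : 𝕋} → ¬ (a ≢ ∞) → a ≡ ∞
  ¬≢∞⇒≡∞ {nothing} _    = refl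
  ¬≢∞⇒≡∞ {just _}  ¬a≢∞ = ⊥-elim (¬a≢∞ λ ())

  +λ-≡∞ : ∀ {I : Set} (y : I → 𝕋) k {l} → y k ≡ ∞ → (y +λ l) k ≡ ∞
  +λ-≡∞ y k {l} = cong (_⊗ just l)

  +λ-≢∞ : ∀ {I : Set} (y : I → 𝕋) k {l} → (y +λ l) k ≢ ∞ → y k ≢ ∞
  +λ-≢∞ y k ne = ne ∘ +λ-≡∞ y k

  MinTwiceOrInf-cong : ∀ {I : Set} {P : I → Set} {f g : I → 𝕋} →
                       f ≗ g → MinTwiceOrInf P f → MinTwiceOrInf P g
  MinTwiceOrInf-cong f≗g (inj₁ all∞) = inj₁ λ k Pk → trans (sym (f≗g k)) (all∞ k Pk)
  MinTwiceOrInf-cong f≗g (inj₂ (i , j , i≢j , Pi , Pj , fi≡fj , fi-min)) =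
    inj₂ (i , j , i≢j , Pi , Pj , trans (sym (f≗g i)) (trans fi≡fj (f≗g j)) ,
          λ k Pk → subst₂ _≤𝕋_ (f≗g i) (f≗g k) (fi-min k Pk))

  module _ {I J : Set} {g : I → 𝕋} (e : J → I) (e-injective : ∀ {a b} → e a ≡ e b → a ≡ b)
           (g-offImage : ∀ k → (∃ λ j → e j ≡ k) ⊎ g k ≡ ∞) where

    MinTwiceOrInf-restrict : MinTwiceOrInf (λ _ → ⊤) g ⇔ MinTwiceOrInf (λ _ → ⊤) (g ∘ e)
    MinTwiceOrInf-restrict = mk⇔ restrict extend
      where
      min∞ : ∀ i → g i ≡ ∞ → (∀ k → ⊤ → g i ≤𝕋 g k) → MinTwiceOrInf (λ _ → ⊤) (g ∘ e)
      min∞ i gi≡∞ gi-min = inj₁ λ k _ → ∞≤𝕋a⇒a≡∞ (subst (_≤𝕋 g (e k)) gi≡∞ (gi-min (e k) tt))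

      restrict : MinTwiceOrInf (λ _ → ⊤) g → MinTwiceOrInf (λ _ → ⊤) (g ∘ e)
      restrict (inj₁ all∞) = inj₁ λ j _ → all∞ (e j) tt
      restrict (inj₂ (i , j , i≢j , _ , _ , gi≡gj , gi-min)) with g-offImage i | g-offImage j
      ... | inj₂ gi≡∞ | _         = min∞ i gi≡∞ gi-min
      ... | inj₁ _    | inj₂ gj≡∞ = min∞ i (trans gi≡gj gj≡∞) gi-min
      ... | inj₁ (a , refl) | inj₁ (b , refl) =
        inj₂ (a , b , i≢j ∘ cong e , tt , tt , gi≡gj , λ k _ → gi-min (e k) tt)

      extend : MinTwiceOrInf (λ _ → ⊤) (g ∘ e) → MinTwiceOrInf (λ _ → ⊤) g
      extend (inj₁ all∞) = inj₁ all∞′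
        where
        all∞′ : ∀ k → ⊤ → g k ≡ ∞
        all∞′ k _ with g-offImage k
        ... | inj₁ (a , refl) = all∞ a tt
        ... | inj₂ gk≡∞       = gk≡∞
      extend (inj₂ (a , b , a≢b , _ , _ , ga≡gb , ga-min)) =
        inj₂ (e a , e b , a≢b ∘ e-injective , tt , tt , ga≡gb , ga-min′)
        where
        ga-min′ : ∀ k → ⊤ → g (e a) ≤𝕋 g k
        ga-min′ k _ with g-offImage k
        ... | inj₁ (c , refl) = ga-min c tt
        ... | inj₂ gk≡∞       = subst (g (e a) ≤𝕋_) (sym gk≡∞) (a≤𝕋∞ (g (e a)))

  Orth-restrict : ∀ {I J : Set} {x y : I → 𝕋} (e : J → I) →
                  (∀ {a b} → e a ≡ e b → a ≡ b) → (∀ k → (∃ λ j → e j ≡ k) ⊎ y k ≡ ∞) →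
                  Orth x y ⇔ Orth (x ∘ e) (y ∘ e)
  Orth-restrict {x = x} {y} e e-injective y-offImage = MinTwiceOrInf-restrict e e-injective xy-offImage
    where
    xy-offImage : ∀ k → (∃ λ j → e j ≡ k) ⊎ x k ⊗ y k ≡ ∞
    xy-offImage k with y-offImage k
    ... | inj₁ k∈image = inj₁ k∈image
    ... | inj₂ yk≡∞    = inj₂ (trans (cong (x k ⊗_) yk≡∞) (a⊗∞≡∞ (x k)))

  Orth-inj₁ : ∀ {A B : Set} {x y : A ⊎ B → 𝕋} → (∀ b → y (inj₂ b) ≡ ∞) →
              Orth x y ⇔ Orth (x ∘ inj₁) (y ∘ inj₁)
  Orth-inj₁ y₂≡∞ = Orth-restrict inj₁ inj₁-injective λ where
    (inj₁ a) → inj₁ (a , refl)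
    (inj₂ b) → inj₂ (y₂≡∞ b)

  Orth-inj₂ : ∀ {A B : Set} {x y : A ⊎ B → 𝕋} → (∀ a → y (inj₁ a) ≡ ∞) →
              Orth x y ⇔ Orth (x ∘ inj₂) (y ∘ inj₂)
  Orth-inj₂ y₁≡∞ = Orth-restrict inj₂ inj₂-injective λ where
    (inj₁ a) → inj₂ (y₁≡∞ a)
    (inj₂ b) → inj₁ (b , refl)

  Orth-congʳ : ∀ {I : Set} {x y y′ : I → 𝕋} → y ≗ y′ → Orth x y ⇔ Orth x y′
  Orth-congʳ {x = x} y≗y′ = mk⇔ (MinTwiceOrInf-cong (cong (x _ ⊗_) ∘ y≗y′))
                                  (MinTwiceOrInf-cong (cong (x _ ⊗_) ∘ sym ∘ y≗y′))

  Homogeneous : ∀ {n} → Vec𝒫 n → Set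
  Homogeneous {n} p = ∀ (S S′ : Subset n) → p S ≢ ∞ → p S′ ≢ ∞ → ∣ S ∣ ≡ ∣ S′ ∣

  dVec-≢∞ : ∀ {n} (p : Vec𝒫 n) {T i} → dVec p T i ≢ ∞ → InS i T × p (T Δ ⁅ i ⁆) ≢ ∞
  dVec-≢∞ p {T} {i} ne with lookup T i
  ... | true  = refl , ne
  ... | false = ⊥-elim (ne refl)

  dVec-hasRankPlusOne : ∀ {n} (p : Vec𝒫 n) {T i} → dVec p T i ≢ ∞ → HasRankPlusOne p T
  dVec-hasRankPlusOne p {T} {i} ne with dVec-≢∞ p ne
  ... | i∈T , pT-i≢∞ = T Δ ⁅ i ⁆ , pT-i≢∞ , ∣S∣≡1+∣SΔ⁅i⁆∣ T i i∈T

  module _ {n} (p : Vec𝒫 n) where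

    cVec-inj₂-≢∞ : ∀ {T i} → cVec p T (inj₂ i) ≢ ∞ → lookup T i ≡ false × p (T Δ ⁅ i ⁆) ≢ ∞
    cVec-inj₂-≢∞ {T} {i} ne rewrite lookup-map i not T with lookup T i
    ... | true  = ⊥-elim (ne refl)
    ... | false = refl , ne

    cVec-inj₂≡dVec-dual : ∀ {T U} → ∁ T ≡ U → ∀ i → cVec p T (inj₂ i) ≡ dVec (dual p) U i
    cVec-inj₂≡dVec-dual {T} refl i =
      cong (λ V → if lookup (∁ T) i then p V else ∞) (sym ∁[∁TΔ⁅i⁆]≡TΔ⁅i⁆)
      where
      ∁[∁TΔ⁅i⁆]≡TΔ⁅i⁆ : ∁ (∁ T Δ ⁅ i ⁆) ≡ T Δ ⁅ i ⁆
      ∁[∁TΔ⁅i⁆]≡TΔ⁅i⁆ = trans (∁-distribˡ-Δ (∁ T) ⁅ i ⁆) (cong (_Δ ⁅ i ⁆) (∁-involutive T))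

    circuit-single-block : Homogeneous p → ∀ {T i j} →
                           cVec p T (inj₁ i) ≢ ∞ → ¬ (cVec p T (inj₂ j) ≢ ∞)
    circuit-single-block homogeneous {T} {i} {j} ne₁ ne₂
      with dVec-≢∞ p ne₁ | cVec-inj₂-≢∞ ne₂
    ... | i∈T , pT-i≢∞ | j∉T , pT+j≢∞ = m≢1+n+m ∣ T Δ ⁅ i ⁆ ∣ {1} (begin
      ∣ T Δ ⁅ i ⁆ ∣             ≡⟨ homogeneous _ _ pT-i≢∞ pT+j≢∞ ⟩
      ∣ T Δ ⁅ j ⁆ ∣             ≡⟨ ∣SΔ⁅i⁆∣≡1+∣S∣ T j j∉T ⟩
      suc ∣ T ∣                 ≡⟨ cong suc (∣S∣≡1+∣SΔ⁅i⁆∣ T i i∈T) ⟩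
      suc (suc ∣ T Δ ⁅ i ⁆ ∣)   ∎)

    Orth-circuit-inj₁ : Homogeneous p → ∀ {T i l} {x : 𝒥 n → 𝕋} → cVec p T (inj₁ i) ≢ ∞ →
                        Orth x (cVec p T +λ l) ⇔ Orth (x ∘ inj₁) (dVec p T +λ l)
    Orth-circuit-inj₁ homogeneous {T} ne₁ =
      Orth-inj₁ λ j → +λ-≡∞ (cVec p T) (inj₂ j) (¬≢∞⇒≡∞ (circuit-single-block homogeneous ne₁))

    Orth-circuit-inj₂ : Homogeneous p → ∀ {T U i l} {x : 𝒥 n → 𝕋} → ∁ T ≡ U →
                        cVec p T (inj₂ i) ≢ ∞ →
                        Orth x (cVec p T +λ l) ⇔ Orth (x ∘ inj₂) (dVec (dual p) U +λ l)
    Orth-circuit-inj₂ homogeneous {T} {l = l} ∁T≡U ne₂ =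
      Orth-congʳ (cong (_⊗ just l) ∘ cVec-inj₂≡dVec-dual ∁T≡U) ⇔-∘
      Orth-inj₂ λ j → +λ-≡∞ (cVec p T) (inj₁ j)
                        (¬≢∞⇒≡∞ λ ne₁ → circuit-single-block homogeneous ne₁ ne₂)

    module _ (homogeneous : Homogeneous p) {x : 𝒥 n → 𝕋} where
      open Equivalence

      InCircuitsPerp⇒L×L* : InCircuitsPerp p x → L p (x ∘ inj₁) × L (dual p) (x ∘ inj₂)
      InCircuitsPerp⇒L×L* perp = xᴸ , x*ᴸ
        where
        xᴸ : L p (x ∘ inj₁)
        xᴸ T _ l (i , ne) =
          to (Orth-circuit-inj₁ homogeneous (+λ-≢∞ (dVec p T) i ne)) (perp T l (inj₁ i , ne))

        x*ᴸ : L (dual p) (x ∘ inj₂)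
        x*ᴸ U _ l (i , ne) =
          to (Orth-circuit-inj₂ homogeneous (∁-involutive U) (+λ-≢∞ (cVec p (∁ U)) (inj₂ i) ne′))
             (perp (∁ U) l (inj₂ i , ne′))
          where
          ne′ : cVec p (∁ U) (inj₂ i) ⊗ just l ≢ ∞
          ne′ = subst (λ t → t ⊗ just l ≢ ∞) (sym (cVec-inj₂≡dVec-dual (∁-involutive U) i)) ne

      L×L*⇒InCircuitsPerp : L p (x ∘ inj₁) × L (dual p) (x ∘ inj₂) → InCircuitsPerp p x
      L×L*⇒InCircuitsPerp (xᴸ , x*ᴸ) T l (inj₁ i , ne) =
        from (Orth-circuit-inj₁ homogeneous (+λ-≢∞ (cVec p T) (inj₁ i) ne))
             (xᴸ T (dVec-hasRankPlusOne p (+λ-≢∞ (dVec p T) i ne)) l (i , ne))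
      L×L*⇒InCircuitsPerp (xᴸ , x*ᴸ) T l (inj₂ i , ne) =
        from (Orth-circuit-inj₂ homogeneous refl (+λ-≢∞ (cVec p T) (inj₂ i) ne))
             (x*ᴸ (∁ T) (dVec-hasRankPlusOne (dual p) (+λ-≢∞ (dVec (dual p) (∁ T)) i ne′)) l (i , ne′))
        where
        ne′ : dVec (dual p) (∁ T) i ⊗ just l ≢ ∞
        ne′ = subst (λ t → t ⊗ just l ≢ ∞) (cVec-inj₂≡dVec-dual refl i) ne

mainTheorem12 : (R : RealLine) → let open Trop R in
    ∀ (n : ℕ) (p : Vec𝒫 n) → IsPlücker p →
    ∀ (x : 𝒥 n → 𝕋) →
      InCircuitsPerp p x ⇔ (L p (λ i → x (inj₁ i)) × L (dual p) (λ i → x (inj₂ i)))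
mainTheorem12 R n p (_ , _ , homogeneous) x =
  mk⇔ (InCircuitsPerp⇒L×L* p homogeneous) (L×L*⇒InCircuitsPerp p homogeneous)
  where open CircuitSpace R
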